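{- Let $\ell$ be a fixed non-negative integer. Let $\mathcal C$ be a hereditary class of graphs containing a semi-induced generalized transversal pair of half-graphs $T_{n,\ell}$ for every positive integer $n$. Then $\mathcal C$ is monadically independent.
   Context: A generalized transversal pair of half-graphs $T_{n,\ell}$ consists of $3+\ell$ sets $A=\{a_{i,j}\}$, $B_0=\{b^0_{i,j}\},\dots,B_\ell=\{b^\ell_{i,j}\}$, $C=\{c_{i,j}\}$ ($i,j\in[n]$) such that $a_{i,j}b^0_{i',j'}$ is an edge iff $(i,j)\leq_{\mathrm{lex}}(i',j')$, for $k\in[\ell]$ $b^{k-1}_{i,j}b^k_{i',j'}$ is an edge iff $(i,j)=(i',j')$, and $b^\ell_{i,j}c_{i',j'}$ is an edge iff $(j,i)\leq_{\mathrm{lex}}(j',i')$, where $\leq_{\mathrm{lex}}$ is the lexicographic order. A semi-induced $T_{n,\ell}$ is such a graph with possibly extra edges only between two sets among $A,B_0,\dots,B_\ell,C$ that have no predefined edges between them. A class is monadically independent if it is not monadically dependent; equivalently (Baldwin–Shelah) if it first-order transduces the class of all finite graphs. -}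

module Defs where

open import Data.Nat using (ℕ; zero; suc)
open import Data.Fin using (Fin; zero; suc; inject₁; fromℕ; _<_; _≤_)
open import Data.Fin.Properties using (_≟_)
open import Data.Bool using (Bool; true; false; _∧_; _∨_; not)
open import Data.Product using (Σ; _×_; _,_; ∃; ∃-syntax)
open import Data.Sum using (_⊎_)
open import Relation.Binary.PropositionalEquality using (_≡_; _≢_)
open import Relation.Nullary.Decidable using (⌊_⌋)
open import Function using (_⇔_)
open import Function.Definitions using (Injective)

record Graph : Set where
  field
    order : ℕ
    adj   : Fin order → Fin order → Bool
    sym   : ∀ u v → adj u v ≡ adj v u
    irr   : ∀ v → adj v v ≡ false
open Graph public

GraphClass : Set₁
GraphClass = Graph → Set

record InducedEmb (H G : Graph) : Set where
  field
    f     : Fin (order H) → Fin (order G)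
    inj   : Injective _≡_ _≡_ f
    pres  : ∀ u v → adj H u v ≡ adj G (f u) (f v)

Hereditary : GraphClass → Set
Hereditary 𝒞 = ∀ G H → 𝒞 G → InducedEmb H G → 𝒞 H

data Part (ℓ : ℕ) : Set where
  pA : Part ℓ
  pB : Fin (suc ℓ) → Part ℓ
  pC : Part ℓ

LexLE : ∀ {n} → Fin n → Fin n → Fin n → Fin n → Set
LexLE i j i' j' = (i < i') ⊎ ((i ≡ i') × (j ≤ j'))

-- G is a semi-induced T_{n,ℓ}: its vertex set is in bijection with the
-- labelled vertices x^p_{i,j} (p a part, i,j ∈ [n]) via `v`, the
-- predefined edges are exactly as prescribed, each part is independent,
-- and edges between non-consecutive parts are arbitrary.
record SemiInducedT (n ℓ : ℕ) (G : Graph) : Set where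
  field
    v     : Part ℓ → Fin n → Fin n → Fin (order G)
    inj   : ∀ p i j q i' j' → v p i j ≡ v q i' j' → (p ≡ q) × (i ≡ i') × (j ≡ j')
    surj  : ∀ w → ∃[ p ] ∃[ i ] ∃[ j ] (v p i j ≡ w)
    indep : ∀ p i j i' j' → adj G (v p i j) (v p i' j') ≡ false
    edgeAB : ∀ i j i' j' →
      (adj G (v pA i j) (v (pB zero) i' j') ≡ true) ⇔ LexLE i j i' j'
    edgeBB : ∀ (k : Fin ℓ) i j i' j' →
      (adj G (v (pB (inject₁ k)) i j) (v (pB (suc k)) i' j') ≡ true)
        ⇔ ((i ≡ i') × (j ≡ j'))
    edgeBC : ∀ i j i' j' →
      (adj G (v (pB (fromℕ ℓ)) i j) (v pC i' j') ≡ true) ⇔ LexLE j i j' i'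

-- First-order logic over graphs with k extra unary predicates (colours).
-- Formulas with m free variables (de Bruijn indices Fin m).

data Formula (k : ℕ) : ℕ → Set where
  ⊤f    : ∀ {m} → Formula k m
  eqf   : ∀ {m} → Fin m → Fin m → Formula k m
  adjf  : ∀ {m} → Fin m → Fin m → Formula k m
  colf  : ∀ {m} → Fin k → Fin m → Formula k m
  ¬f    : ∀ {m} → Formula k m → Formula k m
  _∧f_  : ∀ {m} → Formula k m → Formula k m → Formula k m
  ∃f    : ∀ {m} → Formula k (suc m) → Formula k m

anyFin : (N : ℕ) → (Fin N → Bool) → Bool
anyFin zero    P = false
anyFin (suc N) P = P zero ∨ anyFin N (λ i → P (suc i))

extend : ∀ {N m} → Fin N → (Fin m → Fin N) → Fin (suc m) → Fin N
extend a ρ zero    = a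
extend a ρ (suc i) = ρ i

sat : ∀ {k m} (G : Graph) → (Fin k → Fin (order G) → Bool)
    → Formula k m → (Fin m → Fin (order G)) → Bool
sat G col ⊤f         ρ = true
sat G col (eqf x y)  ρ = ⌊ ρ x ≟ ρ y ⌋
sat G col (adjf x y) ρ = adj G (ρ x) (ρ y)
sat G col (colf c x) ρ = col c (ρ x)
sat G col (¬f φ)     ρ = not (sat G col φ ρ)
sat G col (φ ∧f ψ)   ρ = sat G col φ ρ ∧ sat G col ψ ρ
sat G col (∃f φ)     ρ = anyFin (order G) (λ a → sat G col φ (extend a ρ))

env1 : ∀ {N} → Fin N → Fin 1 → Fin N
env1 a _ = a

env2 : ∀ {N} → Fin N → Fin N → Fin 2 → Fin N
env2 a b zero    = a
env2 a b (suc _) = b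

-- A (simple) transduction with k colours is given by a
-- domain formula δ(x) and an edge formula φ(x,y).
record Output {k : ℕ} (δ : Formula k 1) (φ : Formula k 2) (G H : Graph) : Set where
  field
    col    : Fin k → Fin (order G) → Bool
    f      : Fin (order H) → Fin (order G)
    inj    : Injective _≡_ _≡_ f
    inDom  : ∀ i → sat G col δ (env1 (f i)) ≡ true
    onto   : ∀ w → sat G col δ (env1 w) ≡ true → ∃[ i ] (f i ≡ w)
    edges  : ∀ i j → i ≢ j →
      adj H i j ≡ (sat G col φ (env2 (f i) (f j)) ∨ sat G col φ (env2 (f j) (f i)))

TransducesAllGraphs : GraphClass → Set
TransducesAllGraphs 𝒞 =
  Σ ℕ λ k → Σ (Formula k 1) λ δ → Σ (Formula k 2) λ φ →
    ∀ (H : Graph) → Σ Graph λ G → 𝒞 G × Output δ φ G H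

-- Monadic independence, via the Baldwin–Shelah characterisation stated
-- in the paper's preliminaries.
MonadicallyIndependent : GraphClass → Set
MonadicallyIndependent = TransducesAllGraphs

-- For an m-vertex graph H take a semi-induced T_{m+1,ℓ} and mark the cell (r,c) when r = c or
-- rc is an edge of H; the vertex u of H is the diagonal vertex b⁰_{u,u}.  The first column of A
-- sees b⁰_{r,c} exactly from the a_{i,0} with i ≤ r, so two vertices of B₀ lie in the same row
-- iff they have the same neighbours in that column; dually the last row of C recovers the column
-- of a vertex of B_ℓ.  The matchings B₀–B₁–…–B_ℓ carry a marked cell to its copy in B_ℓ along
-- marked vertices.  Hence uw is an edge of H iff some marked cell in the row of u has its copy in
-- the column of the copy of w, a first-order property of T coloured by these vertex sets.  Only
-- adjacencies between consecutive parts are ever inspected, so the arbitrary extra edges of a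
-- semi-induced T do no harm.

module Submission where

open import Defs
open import Data.Nat using (ℕ; suc)
open import Data.Product using (Σ; _×_)

open import Data.Bool using (Bool; true; false; _∧_; _∨_; not)
open import Data.Bool.Properties using (⇔→≡; ∨-idem; ∧-conicalˡ; ∧-conicalʳ; ∨-conicalˡ; ∨-conicalʳ)
open import Data.Empty using (⊥-elim)
open import Data.Fin using (Fin; zero; suc; inject₁; fromℕ; fromℕ<; toℕ; _≤_)
open import Data.Fin.Properties using (_≟_; ≤-poset; ≤-refl; ≤fromℕ; toℕ-fromℕ<; ≤∧≢⇒<; inject₁-injective)
open import Data.Maybe using (Maybe; just; nothing)
import Data.Maybe as Maybe
import Data.Nat as ℕ
import Data.Nat.Properties as ℕ
open import Data.Product using (_,_; proj₁; proj₂; ∃; ∃-syntax)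
open import Data.Sum using (_⊎_; inj₁; inj₂; [_,_])
open import Function using (_∘_; id; const; _⇔_; mk⇔; Equivalence)
import Function.Properties.Equivalence as ⇔
open import Relation.Binary.Bundles using (Poset)
import Relation.Binary.PropositionalEquality as ≡
open import Relation.Binary.PropositionalEquality
  using (_≡_; _≢_; refl; trans; cong; cong₂; subst; subst₂; module ≡-Reasoning)
open import Relation.Nullary using (Dec; yes; no; contradiction)
open import Relation.Nullary.Decidable using (⌊_⌋; isYes≗does; dec-false)

open Equivalence using (to; from)

∧≡true : ∀ {x y} → x ∧ y ≡ true ⇔ (x ≡ true × y ≡ true)
∧≡true {x} {y} = mk⇔ (λ e → ∧-conicalˡ x y e , ∧-conicalʳ x y e) λ { (refl , refl) → refl }

∨≡true : ∀ {x y} → x ∨ y ≡ true ⇔ (x ≡ true ⊎ y ≡ true)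
∨≡true {true}  = mk⇔ inj₁ (const refl)
∨≡true {false} = mk⇔ inj₂ [ (λ ()) , id ]

∨≡false : ∀ {x y} → x ∨ y ≡ false ⇔ (x ≡ false × y ≡ false)
∨≡false {x} {y} = mk⇔ (λ e → ∨-conicalˡ x y e , ∨-conicalʳ x y e) λ { (refl , refl) → refl }

not≡true : ∀ {x} → not x ≡ true ⇔ x ≡ false
not≡true {true}  = mk⇔ (λ ()) (λ ())
not≡true {false} = mk⇔ (const refl) (const refl)

∧-not≡false : ∀ {x y} → x ∧ not y ≡ false ⇔ (x ≡ true → y ≡ true)
∧-not≡false {false}        = mk⇔ (λ _ ()) (const refl)
∧-not≡false {true} {true}  = mk⇔ (const (const refl)) (const refl)
∧-not≡false {true} {false} = mk⇔ (λ ()) (λ h → contradiction (h refl) λ ())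

iff≡true : ∀ {x y} → not (x ∧ not y) ∧ not (y ∧ not x) ≡ true ⇔ x ≡ y
iff≡true {false} {false} = mk⇔ (const refl) (const refl)
iff≡true {false} {true}  = mk⇔ (λ ()) (λ ())
iff≡true {true}  {false} = mk⇔ (λ ()) (λ ())
iff≡true {true}  {true}  = mk⇔ (const refl) (const refl)

isYes≡true : ∀ {P : Set} (P? : Dec P) → ⌊ P? ⌋ ≡ true ⇔ P
isYes≡true (yes p) = mk⇔ (const p) (const refl)
isYes≡true (no ¬p) = mk⇔ (λ ()) (⊥-elim ∘ ¬p)

≟-refl : ∀ {n} (x : Fin n) → ⌊ x ≟ x ⌋ ≡ true
≟-refl x = from (isYes≡true (x ≟ x)) refl

anyFin≡true : ∀ N {P} → anyFin N P ≡ true ⇔ (∃[ i ] P i ≡ true)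
anyFin≡true ℕ.zero    = mk⇔ (λ ()) λ { (() , _) }
anyFin≡true (suc N) {P} = mk⇔ to′ from′
  where
  rest = anyFin≡true N {P ∘ suc}
  to′ : anyFin (suc N) P ≡ true → ∃[ i ] P i ≡ true
  to′ e with to (∨≡true {P zero}) e
  ... | inj₁ e₀ = zero , e₀
  ... | inj₂ e₁ = let i , eᵢ = to rest e₁ in suc i , eᵢ
  from′ : ∃[ i ] P i ≡ true → anyFin (suc N) P ≡ true
  from′ (zero  , e) = from ∨≡true (inj₁ e)
  from′ (suc i , e) = from (∨≡true {P zero}) (inj₂ (from rest (i , e)))

anyFin≡false : ∀ N {P} → anyFin N P ≡ false ⇔ (∀ i → P i ≡ false)
anyFin≡false ℕ.zero    = mk⇔ (λ _ ()) (const refl)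
anyFin≡false (suc N) {P} = mk⇔
  (λ e → λ { zero → proj₁ (to ∨≡false e) ; (suc i) → to rest (proj₂ (to (∨≡false {P zero}) e)) i })
  (λ h → from ∨≡false (h zero , from rest (h ∘ suc)))
  where rest = anyFin≡false N {P ∘ suc}

module _ {c ℓ₁ ℓ₂} (P : Poset c ℓ₁ ℓ₂) where
  open Poset P using (_≈_; antisym) renaming (_≤_ to _≼_; refl to ≼-refl)

  lowerSet-injective : ∀ {x y} → (∀ z → z ≼ x ⇔ z ≼ y) → x ≈ y
  lowerSet-injective {x} {y} h = antisym (to (h x) ≼-refl) (from (h y) ≼-refl)

  upperSet-injective : ∀ {x y} → (∀ z → x ≼ z ⇔ y ≼ z) → x ≈ y
  upperSet-injective {x} {y} h = antisym (from (h y) ≼-refl) (to (h x) ≼-refl)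

LexLE⇔≤ : ∀ {n} {i j i′ j′ : Fin n} → j ≤ j′ → LexLE i j i′ j′ ⇔ i ≤ i′
LexLE⇔≤ {i = i} {j} {i′} {j′} j≤j′ = mk⇔ lex⇒≤ ≤⇒lex
  where
  lex⇒≤ : LexLE i j i′ j′ → i ≤ i′
  lex⇒≤ (inj₁ i<i′)       = ℕ.<⇒≤ i<i′
  lex⇒≤ (inj₂ (refl , _)) = ≤-refl

  ≤⇒lex : i ≤ i′ → LexLE i j i′ j′
  ≤⇒lex i≤i′ with i ≟ i′
  ... | yes refl = inj₂ (refl , j≤j′)
  ... | no i≢i′  = inj₁ (≤∧≢⇒< i≤i′ i≢i′)

lower : ∀ {n} → Fin (suc n) → Maybe (Fin n)
lower {ℕ.zero}  zero    = nothing
lower {suc n}   zero    = just zero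
lower {suc n}   (suc i) = Maybe.map suc (lower i)

lower-inject₁ : ∀ {n} (i : Fin n) → lower (inject₁ i) ≡ just i
lower-inject₁ zero    = refl
lower-inject₁ (suc i) = cong (Maybe.map suc) (lower-inject₁ i)

inject₁-lower : ∀ {n} (i : Fin (suc n)) {j} → lower i ≡ just j → inject₁ j ≡ i
inject₁-lower {suc n} zero    refl = refl
inject₁-lower {suc n} (suc i) e with lower i in eq
inject₁-lower {suc n} (suc i) refl | just j = cong suc (inject₁-lower i eq)

-- cap n = min n ℓ; it is only ever used with n ≤ ℓ.
cap : ∀ {ℓ} → ℕ → Fin (suc ℓ)
cap {ℓ}      ℕ.zero  = zero
cap {ℕ.zero} (suc n) = zero
cap {suc ℓ}  (suc n) = suc (cap n)

cap-fromℕ : ∀ ℓ → cap {ℓ} ℓ ≡ fromℕ ℓ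
cap-fromℕ ℕ.zero  = refl
cap-fromℕ (suc ℓ) = cong suc (cap-fromℕ ℓ)

cap-toℕ : ∀ {ℓ} (k : Fin ℓ) → cap (toℕ k) ≡ inject₁ k
cap-toℕ zero    = refl
cap-toℕ (suc k) = cong suc (cap-toℕ k)

cap-suc-toℕ : ∀ {ℓ} (k : Fin ℓ) → cap (suc (toℕ k)) ≡ suc k
cap-suc-toℕ {suc ℓ} zero    = refl
cap-suc-toℕ         (suc k) = cong suc (cap-suc-toℕ k)

module _ {k : ℕ} where

  Iff : ∀ {M} → Formula k M → Formula k M → Formula k M
  Iff φ ψ = ¬f (φ ∧f ¬f ψ) ∧f ¬f (ψ ∧f ¬f φ)

  Agree : ∀ {M} → Fin k → Formula k (suc M) → Formula k (suc M) → Formula k M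
  Agree c φ ψ = ¬f (∃f (colf c zero ∧f ¬f (Iff φ ψ)))

  SameNbhd : ∀ {M} → Fin k → Fin M → Fin M → Formula k M
  SameNbhd c x y = Agree c (adjf zero (suc x)) (adjf zero (suc y))

module Semantics {k} (G : Graph) (col : Fin k → Fin (order G) → Bool) where

  infix 4 _⊨_
  -- Opaque so that ρ ⊨ φ is unified by its formula rather than by the Boolean that sat unfolds to.
  opaque
    _⊨_ : ∀ {M} → (Fin M → Fin (order G)) → Formula k M → Set
    ρ ⊨ φ = sat G col φ ρ ≡ true

  module _ {M} {ρ : Fin M → Fin (order G)} where
   opaque
    unfolding _⊨_

    ⊨⇔sat≡true : ∀ {φ} → ρ ⊨ φ ⇔ sat G col φ ρ ≡ true
    ⊨⇔sat≡true = mk⇔ id id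

    ⊨-∧ : ∀ {φ ψ} → ρ ⊨ φ ∧f ψ ⇔ (ρ ⊨ φ × ρ ⊨ ψ)
    ⊨-∧ = ∧≡true

    ⊨-∃ : ∀ {φ} → ρ ⊨ ∃f φ ⇔ (∃[ a ] extend a ρ ⊨ φ)
    ⊨-∃ = anyFin≡true (order G)

    ⊨-eq : ∀ {x y} → ρ ⊨ eqf x y ⇔ ρ x ≡ ρ y
    ⊨-eq {x} {y} = isYes≡true (ρ x ≟ ρ y)

    ⊨-adj : ∀ {x y} → ρ ⊨ adjf x y ⇔ adj G (ρ x) (ρ y) ≡ true
    ⊨-adj = mk⇔ id id

    ⊨-colf : ∀ {c x} → ρ ⊨ colf c x ⇔ col c (ρ x) ≡ true
    ⊨-colf = mk⇔ id id

    ⊨-Agree : ∀ {c φ ψ} → ρ ⊨ Agree c φ ψ ⇔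
      (∀ a → col c a ≡ true → sat G col φ (extend a ρ) ≡ sat G col ψ (extend a ρ))
    ⊨-Agree = mk⇔
      (λ h a cₐ → to iff≡true (to ∧-not≡false (to (anyFin≡false (order G)) (to not≡true h) a) cₐ))
      (λ h → from not≡true (from (anyFin≡false (order G)) λ a →
                from ∧-not≡false λ cₐ → from iff≡true (h a cₐ)))

    ⊨-SameNbhd : ∀ {c x y} →
      ρ ⊨ SameNbhd c x y ⇔ (∀ a → col c a ≡ true → adj G a (ρ x) ≡ adj G a (ρ y))
    ⊨-SameNbhd {c} {x} {y} = ⊨-Agree {c = c} {adjf zero (suc x)} {adjf zero (suc y)}

module Transversal {n ℓ} {G : Graph} (T : SemiInducedT (suc n) ℓ G) where
  open SemiInducedT T

  Bℓ : Part ℓ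
  Bℓ = pB (fromℕ ℓ)

  decode : ∀ w → ∃[ p ] ∃[ i ] ∃[ j ] w ≡ v p i j
  decode w = let p , i , j , e = surj w in p , i , j , ≡.sym e

  adj-columnA : ∀ {i r c} → adj G (v pA i zero) (v (pB zero) r c) ≡ true ⇔ i ≤ r
  adj-columnA {i} {r} {c} = ⇔.trans (edgeAB i zero r c) (LexLE⇔≤ ℕ.z≤n)

  adj-lastRowC : ∀ {j r c} → adj G (v pC (fromℕ n) j) (v Bℓ r c) ≡ true ⇔ c ≤ j
  adj-lastRowC {j} {r} {c} = subst (λ b → b ≡ true ⇔ c ≤ j) (Graph.sym G _ _)
    (⇔.trans (edgeBC r c (fromℕ n) j) (LexLE⇔≤ (≤fromℕ r)))

  adj-nextLayer : ∀ {m} → suc m ℕ.≤ ℓ → ∀ {r c i j} →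
    adj G (v (pB (cap m)) r c) (v (pB (cap (suc m))) i j) ≡ true ⇔ (r ≡ i × c ≡ j)
  adj-nextLayer m<ℓ {r} {c} {i} {j} = subst Adjacent (toℕ-fromℕ< m<ℓ) (consecutive (fromℕ< m<ℓ))
    where
    Adjacent : ℕ → Set
    Adjacent m = adj G (v (pB (cap m)) r c) (v (pB (cap (suc m))) i j) ≡ true ⇔ (r ≡ i × c ≡ j)
    consecutive : ∀ k → Adjacent (toℕ k)
    consecutive k = subst₂ (λ a b → adj G (v (pB a) r c) (v (pB b) i j) ≡ true ⇔ (r ≡ i × c ≡ j))
      (≡.sym (cap-toℕ k)) (≡.sym (cap-suc-toℕ k)) (edgeBB k r c i j)

Colours : ℕ → ℕ
Colours ℓ = 3 ℕ.+ suc ℓ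

pattern columnA  = zero
pattern lastRowC = suc zero
pattern diagonal = suc (suc zero)
pattern layer k  = suc (suc (suc k))

module Formulas (ℓ : ℕ) where

  Copy : ℕ → ∀ {M} → Fin M → Fin M → Formula (Colours ℓ) M
  Copy ℕ.zero  s t = colf (layer zero) t ∧f eqf s t
  Copy (suc n) s t = colf (layer (cap (suc n))) t ∧f ∃f (Copy n (suc s) zero ∧f adjf zero (suc t))

  Vertex : Formula (Colours ℓ) 1
  Vertex = colf diagonal zero

  InColumnOfCopy : Formula (Colours ℓ) 5
  InColumnOfCopy = Copy ℓ (suc (suc (suc (suc zero)))) zero ∧f SameNbhd lastRowC (suc zero) zero

  CopyInColumn : Formula (Colours ℓ) 4
  CopyInColumn = Copy ℓ (suc zero) zero ∧f ∃f InColumnOfCopy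

  MarkedInRow : Formula (Colours ℓ) 3
  MarkedInRow = colf (layer zero) zero ∧f (SameNbhd columnA zero (suc zero) ∧f ∃f CopyInColumn)

  Edge : Formula (Colours ℓ) 2
  Edge = ∃f MarkedInRow

module Construction {ℓ} (H G : Graph) (T : SemiInducedT (suc (order H)) ℓ G) where
  open SemiInducedT T
  open Transversal T
  open Formulas ℓ

  Index : Set
  Index = Fin (suc (order H))

  markedAt : Maybe (Fin (order H)) → Maybe (Fin (order H)) → Bool
  markedAt (just u) (just w) = ⌊ u ≟ w ⌋ ∨ adj H u w
  markedAt _        _        = false

  marked : Index → Index → Bool
  marked r c = markedAt (lower r) (lower c)

  marked-inject₁ : ∀ u w → marked (inject₁ u) (inject₁ w) ≡ ⌊ u ≟ w ⌋ ∨ adj H u w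
  marked-inject₁ u w = cong₂ markedAt (lower-inject₁ u) (lower-inject₁ w)

  marked-diagonal : ∀ u → marked (inject₁ u) (inject₁ u) ≡ true
  marked-diagonal u = trans (marked-inject₁ u u) (from ∨≡true (inj₁ (≟-refl u)))

  marked-offDiagonal : ∀ {u w} → u ≢ w → marked (inject₁ u) (inject₁ w) ≡ adj H u w
  marked-offDiagonal {u} {w} u≢w =
    trans (marked-inject₁ u w) (cong (_∨ adj H u w) (trans (isYes≗does (u ≟ w)) (dec-false (u ≟ w) u≢w)))

  marked-diagonal⁻¹ : ∀ r → marked r r ≡ true → ∃[ u ] inject₁ u ≡ r
  marked-diagonal⁻¹ r e with lower r in eq
  ... | just u = u , inject₁-lower r eq

  -- Indices below fromℕ (order H) are the vertices of H.  The extra index fromℕ (order H) is only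
  -- used for the row of C, since c_{m,j} is adjacent to b^ℓ_{r,c} iff c ≤ j for every row r.
  colourOf : Fin (Colours ℓ) → Part ℓ → Index → Index → Bool
  colourOf columnA   pA        i j = ⌊ j ≟ zero ⌋
  colourOf lastRowC  pC        i j = ⌊ i ≟ fromℕ (order H) ⌋
  colourOf diagonal  (pB zero) i j = ⌊ i ≟ j ⌋ ∧ marked i j
  colourOf (layer k) (pB k′)   i j = ⌊ k ≟ k′ ⌋ ∧ marked i j
  colourOf _         _         _ _ = false

  col : Fin (Colours ℓ) → Fin (order G) → Bool
  col c w = let p , i , j , _ = decode w in colourOf c p i j

  col-v : ∀ c p i j → col c (v p i j) ≡ colourOf c p i j
  col-v c p i j with surj (v p i j)
  ... | p′ , i′ , j′ , e with inj p′ i′ j′ p i j e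
  ... | refl , refl , refl = refl

  col-elim : ∀ c {w} → col c w ≡ true → ∃[ p ] ∃[ i ] ∃[ j ] (w ≡ v p i j × colourOf c p i j ≡ true)
  col-elim c {w} e with decode w
  ... | p , i , j , refl = p , i , j , refl , trans (≡.sym (col-v c p i j)) e

  columnA-elim : ∀ {w} → col columnA w ≡ true → ∃[ i ] w ≡ v pA i zero
  columnA-elim e with col-elim columnA e
  ... | pA , i , j , refl , e′ = i , cong (v pA i) (to (isYes≡true (j ≟ zero)) e′)

  columnA-intro : ∀ {i} → col columnA (v pA i zero) ≡ true
  columnA-intro {i} = trans (col-v columnA pA i zero) (≟-refl (zero {order H}))

  lastRowC-elim : ∀ {w} → col lastRowC w ≡ true → ∃[ j ] w ≡ v pC (fromℕ (order H)) j
  lastRowC-elim e with col-elim lastRowC e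
  ... | pC , i , j , refl , e′ = j , cong (λ i′ → v pC i′ j) (to (isYes≡true (i ≟ fromℕ _)) e′)

  lastRowC-intro : ∀ {j} → col lastRowC (v pC (fromℕ (order H)) j) ≡ true
  lastRowC-intro {j} = trans (col-v lastRowC pC _ j) (≟-refl (fromℕ (order H)))

  layer-elim : ∀ {k w} → col (layer k) w ≡ true → ∃[ i ] ∃[ j ] (w ≡ v (pB k) i j × marked i j ≡ true)
  layer-elim {k} e with col-elim (layer k) e
  ... | pB k′ , i , j , refl , e′ with to ∧≡true e′
  ... | k≡k′ , mij = i , j , cong (λ k″ → v (pB k″) i j) (≡.sym (to (isYes≡true (k ≟ k′)) k≡k′)) , mij

  layer-intro : ∀ {k i j} → marked i j ≡ true → col (layer k) (v (pB k) i j) ≡ true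
  layer-intro {k} {i} {j} mij = trans (col-v (layer k) (pB k) i j) (from ∧≡true (≟-refl k , mij))

  vertex : Fin (order H) → Fin (order G)
  vertex u = v (pB zero) (inject₁ u) (inject₁ u)

  vertex-injective : ∀ {u w} → vertex u ≡ vertex w → u ≡ w
  vertex-injective e = inject₁-injective (proj₁ (proj₂ (inj _ _ _ _ _ _ e)))

  diagonal-elim : ∀ w → col diagonal w ≡ true → ∃[ u ] vertex u ≡ w
  diagonal-elim w e with col-elim diagonal e
  ... | pB zero , i , j , refl , e′ with to ∧≡true e′
  ... | i≡j , mij with to (isYes≡true (i ≟ j)) i≡j
  ... | refl with marked-diagonal⁻¹ i mij
  ... | u , refl = u , refl

  diagonal-intro : ∀ u → col diagonal (vertex u) ≡ true
  diagonal-intro u = trans (col-v diagonal (pB zero) _ _)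
    (from ∧≡true (≟-refl (inject₁ u) , marked-diagonal u))

  columnA-agree : ∀ {r c r′ c′} →
    (∀ a → col columnA a ≡ true → adj G a (v (pB zero) r c) ≡ adj G a (v (pB zero) r′ c′)) ⇔ r ≡ r′
  columnA-agree {r} {c} {r′} {c′} = mk⇔
    (λ agree → lowerSet-injective (≤-poset _) λ i → let same = agree _ columnA-intro in mk⇔
      (λ i≤r  → to adj-columnA (trans (≡.sym same) (from adj-columnA i≤r)))
      (λ i≤r′ → to adj-columnA (trans same (from adj-columnA i≤r′))))
    λ { refl a cₐ → let i , a≡aᵢ = columnA-elim cₐ in
          subst (λ a → adj G a _ ≡ adj G a _) (≡.sym a≡aᵢ)
            (⇔→≡ (⇔.trans adj-columnA (⇔.sym adj-columnA))) }

  lastRowC-agree : ∀ {r c r′ c′} →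
    (∀ a → col lastRowC a ≡ true → adj G a (v Bℓ r c) ≡ adj G a (v Bℓ r′ c′)) ⇔ c ≡ c′
  lastRowC-agree {r} {c} {r′} {c′} = mk⇔
    (λ agree → upperSet-injective (≤-poset _) λ j → let same = agree _ lastRowC-intro in mk⇔
      (λ c≤j  → to adj-lastRowC (trans (≡.sym same) (from adj-lastRowC c≤j)))
      (λ c′≤j → to adj-lastRowC (trans same (from adj-lastRowC c′≤j))))
    λ { refl a cₐ → let j , a≡cⱼ = lastRowC-elim cₐ in
          subst (λ a → adj G a _ ≡ adj G a _) (≡.sym a≡cⱼ)
            (⇔→≡ (⇔.trans adj-lastRowC (⇔.sym adj-lastRowC))) }

  open Semantics G col

  module _ {M} {ρ : Fin M → Fin (order G)} {x y : Fin M} where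

    ⊨-sameRow : ∀ {r c r′ c′} → ρ x ≡ v (pB zero) r c → ρ y ≡ v (pB zero) r′ c′ →
      ρ ⊨ SameNbhd columnA x y ⇔ r ≡ r′
    ⊨-sameRow {r} {c} {r′} {c′} ex ey = ⇔.trans (⊨-SameNbhd {ρ = ρ} {c = columnA} {x} {y})
      (subst₂ (λ p q → (∀ a → col columnA a ≡ true → adj G a p ≡ adj G a q) ⇔ r ≡ r′)
        (≡.sym ex) (≡.sym ey) columnA-agree)

    ⊨-sameColumn : ∀ {r c r′ c′} → ρ x ≡ v Bℓ r c → ρ y ≡ v Bℓ r′ c′ →
      ρ ⊨ SameNbhd lastRowC x y ⇔ c ≡ c′
    ⊨-sameColumn {r} {c} {r′} {c′} ex ey = ⇔.trans (⊨-SameNbhd {ρ = ρ} {c = lastRowC} {x} {y})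
      (subst₂ (λ p q → (∀ a → col lastRowC a ≡ true → adj G a p ≡ adj G a q) ⇔ c ≡ c′)
        (≡.sym ex) (≡.sym ey) lastRowC-agree)

  ⊨-Copy : ∀ n → n ℕ.≤ ℓ → ∀ {M} {ρ : Fin M → Fin (order G)} {s t r c} →
    ρ s ≡ v (pB zero) r c → marked r c ≡ true →
    ρ ⊨ Copy n s t ⇔ ρ t ≡ v (pB (cap n)) r c
  ⊨-Copy ℕ.zero _ {ρ = ρ} {s} {t} es mrc = mk⇔
    (λ h → trans (≡.sym (to (⊨-eq {ρ = ρ} {s} {t}) (proj₂ (to ⊨-∧ h)))) es)
    (λ et → from ⊨-∧ (from ⊨-colf (subst (λ w → col (layer zero) w ≡ true) (≡.sym et) (layer-intro mrc)) ,
                      from ⊨-eq (trans es (≡.sym et))))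
  ⊨-Copy (suc n) n<ℓ {ρ = ρ} {s} {t} {r} {c} es mrc = mk⇔ copy⇒ copy⇐
    where
    previous : ∀ z → extend z ρ ⊨ Copy n (suc s) zero ⇔ z ≡ v (pB (cap n)) r c
    previous z = ⊨-Copy n (ℕ.<⇒≤ n<ℓ) es mrc

    copy⇒ : ρ ⊨ Copy (suc n) s t → ρ t ≡ v (pB (cap (suc n))) r c
    copy⇒ h =
      let cₜ , h′         = to ⊨-∧ h
          z , h″          = to ⊨-∃ h′
          copyZ , adjZt   = to ⊨-∧ h″
          i , j , et , _  = layer-elim (to ⊨-colf cₜ)
          r≡i , c≡j       = to (adj-nextLayer n<ℓ)
            (subst₂ (λ a b → adj G a b ≡ true) (to (previous z) copyZ) et (to ⊨-adj adjZt))
      in subst₂ (λ a b → ρ t ≡ v (pB (cap (suc n))) a b) (≡.sym r≡i) (≡.sym c≡j) et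

    copy⇐ : ρ t ≡ v (pB (cap (suc n))) r c → ρ ⊨ Copy (suc n) s t
    copy⇐ et = from ⊨-∧
      ( from ⊨-colf (subst (λ w → col (layer _) w ≡ true) (≡.sym et) (layer-intro mrc))
      , from ⊨-∃ (_ , from ⊨-∧ (from (previous _) refl ,
          from ⊨-adj (subst (λ w → adj G _ w ≡ true) (≡.sym et) (from (adj-nextLayer n<ℓ) (refl , refl))))))

  ⊨-Copyℓ : ∀ {M} {ρ : Fin M → Fin (order G)} {s t r c} →
    ρ s ≡ v (pB zero) r c → marked r c ≡ true → ρ ⊨ Copy ℓ s t ⇔ ρ t ≡ v Bℓ r c
  ⊨-Copyℓ {ρ = ρ} {s} {t} {r} {c} es mrc =
    subst (λ k → ρ ⊨ Copy ℓ s t ⇔ ρ t ≡ v (pB k) r c) (cap-fromℕ ℓ) (⊨-Copy ℓ ℕ.≤-refl es mrc)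

  ⊨-Edge : ∀ {u w} → env2 (vertex u) (vertex w) ⊨ Edge ⇔ marked (inject₁ u) (inject₁ w) ≡ true
  ⊨-Edge {u} {w} = mk⇔ edge⇒marked marked⇒edge
    where
    edge⇒marked : env2 (vertex u) (vertex w) ⊨ Edge → marked (inject₁ u) (inject₁ w) ≡ true
    edge⇒marked h =
      let s , h₁           = to ⊨-∃ h
          cₛ , h₂          = to ⊨-∧ h₁
          row , h₃         = to ⊨-∧ h₂
          t , h₄           = to ⊨-∃ h₃
          copyT , h₅       = to ⊨-∧ h₄
          y′ , h₆          = to ⊨-∃ h₅
          copyY , column   = to ⊨-∧ h₆
          i , j , es , mij = layer-elim (to ⊨-colf cₛ)
          i≡u = to (⊨-sameRow es refl) row
          j≡w = to (⊨-sameColumn (to (⊨-Copyℓ es mij) copyT)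
                                 (to (⊨-Copyℓ refl (marked-diagonal w)) copyY)) column
      in subst₂ (λ a b → marked a b ≡ true) i≡u j≡w mij

    marked⇒edge : marked (inject₁ u) (inject₁ w) ≡ true → env2 (vertex u) (vertex w) ⊨ Edge
    marked⇒edge muw = from ⊨-∃ (s , markedInRow)
      where
      s  = v (pB zero) (inject₁ u) (inject₁ w)
      t  = v Bℓ (inject₁ u) (inject₁ w)
      y′ = v Bℓ (inject₁ w) (inject₁ w)
      ρ₁ = extend s (env2 (vertex u) (vertex w))
      ρ₂ = extend t ρ₁
      ρ₃ = extend y′ ρ₂

      inColumnOfCopy : ρ₃ ⊨ InColumnOfCopy
      inColumnOfCopy =
        from ⊨-∧ (from (⊨-Copyℓ refl (marked-diagonal w)) refl , from (⊨-sameColumn refl refl) refl)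

      copyInColumn : ρ₂ ⊨ CopyInColumn
      copyInColumn = from ⊨-∧ (from (⊨-Copyℓ refl muw) refl , from ⊨-∃ (y′ , inColumnOfCopy))

      markedInRow : ρ₁ ⊨ MarkedInRow
      markedInRow = from ⊨-∧ (from ⊨-colf (layer-intro muw) ,
        from ⊨-∧ (from (⊨-sameRow refl refl) refl , from ⊨-∃ (t , copyInColumn)))

  edge-sat : ∀ {u w} → u ≢ w → sat G col Edge (env2 (vertex u) (vertex w)) ≡ adj H u w
  edge-sat {u} {w} u≢w = ⇔→≡ (⇔.trans (⇔.sym ⊨⇔sat≡true)
    (subst (λ b → env2 (vertex u) (vertex w) ⊨ Edge ⇔ b ≡ true) (marked-offDiagonal u≢w) ⊨-Edge))

  output : Output Vertex Edge G H
  output = record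
    { col   = col
    ; f     = vertex
    ; inj   = vertex-injective
    ; inDom = diagonal-intro
    ; onto  = diagonal-elim
    ; edges = edges
    }
    where
    open ≡-Reasoning
    edges : ∀ u w → u ≢ w →
      adj H u w ≡ (sat G col Edge (env2 (vertex u) (vertex w)) ∨ sat G col Edge (env2 (vertex w) (vertex u)))
    edges u w u≢w = begin
      adj H u w                ≡⟨ ∨-idem _ ⟨
      adj H u w ∨ adj H u w    ≡⟨ cong (adj H u w ∨_) (Graph.sym H u w) ⟩
      adj H u w ∨ adj H w u    ≡⟨ cong₂ _∨_ (edge-sat u≢w) (edge-sat (u≢w ∘ ≡.sym)) ⟨
      sat G col Edge (env2 (vertex u) (vertex w)) ∨ sat G col Edge (env2 (vertex w) (vertex u)) ∎

lemma2p17 : (ℓ : ℕ) (𝒞 : GraphClass) → Hereditary 𝒞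
    → (∀ (n : ℕ) → Σ Graph (λ G → 𝒞 G × SemiInducedT (suc n) ℓ G))
    → MonadicallyIndependent 𝒞
lemma2p17 ℓ 𝒞 _ hasT = Colours ℓ , Formulas.Vertex ℓ , Formulas.Edge ℓ , λ H →
  let G , G∈𝒞 , T = hasT (order H) in G , G∈𝒞 , Construction.output H G T
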